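{- For types $A,B,C_1,C_2$: if $A\Rightarrow B\equiv C_1\wedge C_2$, then there exist types $B_1,B_2$ with $C_1\equiv A\Rightarrow B_1$, $C_2\equiv A\Rightarrow B_2$ and $B\equiv B_1\wedge B_2$.
   Context: Types are generated by $A ::= \tau \mid A\Rightarrow A \mid A\wedge A$, where $\tau$ is the only atomic type ($\Rightarrow$ associates to the right). Type equivalence $\equiv$ is the smallest congruence on types such that $A\wedge B\equiv B\wedge A$, $A\wedge(B\wedge C)\equiv(A\wedge B)\wedge C$, $A\Rightarrow(B\wedge C)\equiv(A\Rightarrow B)\wedge(A\Rightarrow C)$ and $(A\wedge B)\Rightarrow C\equiv A\Rightarrow B\Rightarrow C$. -}

module Defs where


infixr 6 _⇒_
infixr 7 _∧_
data Ty : Set where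
  τ   : Ty
  _⇒_ : Ty → Ty → Ty
  _∧_ : Ty → Ty → Ty

infix 4 _≡ᵗ_
data _≡ᵗ_ : Ty → Ty → Set where
  refl  : ∀ {A} → A ≡ᵗ A
  sym   : ∀ {A B} → A ≡ᵗ B → B ≡ᵗ A
  trans : ∀ {A B C} → A ≡ᵗ B → B ≡ᵗ C → A ≡ᵗ C
  cong⇒ : ∀ {A A' B B'} → A ≡ᵗ A' → B ≡ᵗ B' → (A ⇒ B) ≡ᵗ (A' ⇒ B')
  cong∧ : ∀ {A A' B B'} → A ≡ᵗ A' → B ≡ᵗ B' → (A ∧ B) ≡ᵗ (A' ∧ B')
  comm   : ∀ {A B} → (A ∧ B) ≡ᵗ (B ∧ A)
  assoc  : ∀ {A B C} → (A ∧ (B ∧ C)) ≡ᵗ ((A ∧ B) ∧ C)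
  distr  : ∀ {A B C} → (A ⇒ (B ∧ C)) ≡ᵗ ((A ⇒ B) ∧ (A ⇒ C))
  curry  : ∀ {A B C} → ((A ∧ B) ⇒ C) ≡ᵗ (A ⇒ B ⇒ C)

module Submission where

-- Every type is equivalent to a conjunction of "arrows"
-- P₁ ⇒ ⋯ ⇒ Pₙ ⇒ τ whose premises are again arrows; such a normal form is a
-- finite tree (Nf) and a type is interpreted as the nonempty list ⟦ X ⟧ of
-- its conjuncts.  Two normal forms are identified (≈, ≋) when they agree up
-- to reordering of premises and conjuncts at every depth.
--   * soundness:   X ≡ᵗ Y implies ⟦ X ⟧ ≋ ⟦ Y ⟧;
--   * reification: ⋀ turns a list of normal forms back into a type, it
--     respects ≋, and X ≡ᵗ ⋀ ⟦ X ⟧ for every type X;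
--   * structure of ≋: it is a permutation followed by a pointwise ≈.
-- For the theorem, ⟦ A ⇒ B ⟧ is ⟦ B ⟧ with the premises of A added to each
-- conjunct.  After permuting ⟦ B ⟧ into bs, the conjuncts of C₁ ∧ C₂ match
-- those of A ⇒ bs one by one, so bs splits as bs₁ ++ bs₂ along ⟦ C₁ ⟧ and
-- ⟦ C₂ ⟧, and Bᵢ = ⋀ bsᵢ are the required types.

open import Data.List using (List; []; _∷_; _++_; map; foldl)
open import Data.List.NonEmpty as List⁺ using (List⁺; _∷_; [_]; _⁺++⁺_; toList)
open import Data.List.Properties using (++-assoc; map-++; map-cong; map-∘; foldl-++)
open import Data.List.Relation.Binary.Pointwise as Pointwise using (Pointwise; []; _∷_)
open import Data.List.Relation.Binary.Permutation.Propositional as ↭ using (_↭_)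
open import Data.List.Relation.Binary.Permutation.Propositional.Properties using (++-comm; ↭-map-inv)
open import Data.Product using (Σ-syntax; _×_; _,_; ∃; ∃₂)
open import Relation.Binary.PropositionalEquality as ≡ using (_≡_)
open import Defs

≡⇒≡ᵗ : ∀ {X Y} → X ≡ Y → X ≡ᵗ Y
≡⇒≡ᵗ ≡.refl = refl

exchange : ∀ {X Y Z} → X ⇒ Y ⇒ Z ≡ᵗ Y ⇒ X ⇒ Z
exchange = trans (sym curry) (trans (cong⇒ comm refl) curry)

rotate : ∀ {X Y Z} → (X ∧ Y) ∧ Z ≡ᵗ (X ∧ Z) ∧ Y
rotate = trans (sym assoc) (trans (cong∧ refl comm) assoc)

-- Normal forms.  `node [ m₁ , … , mₙ ]` stands for m₁ ⇒ ⋯ ⇒ mₙ ⇒ τ.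
data Nf : Set where
  node : List Nf → Nf

infix 4 _≈_ _≋_

mutual
  data _≈_ : Nf → Nf → Set where
    node : ∀ {xs ys} → xs ≋ ys → node xs ≈ node ys

  data _≋_ : List Nf → List Nf → Set where
    []      : [] ≋ []
    _∷_     : ∀ {x y xs ys} → x ≈ y → xs ≋ ys → x ∷ xs ≋ y ∷ ys
    swap    : ∀ x y xs → x ∷ y ∷ xs ≋ y ∷ x ∷ xs
    ≋-trans : ∀ {xs ys zs} → xs ≋ ys → ys ≋ zs → xs ≋ zs

mutual
  ≈-refl : ∀ {x} → x ≈ x
  ≈-refl {node xs} = node (≋-refl xs)

  ≋-refl : ∀ xs → xs ≋ xs
  ≋-refl []       = []
  ≋-refl (x ∷ xs) = ≈-refl ∷ ≋-refl xs

mutual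
  ≈-sym : ∀ {x y} → x ≈ y → y ≈ x
  ≈-sym (node p) = node (≋-sym p)

  ≋-sym : ∀ {xs ys} → xs ≋ ys → ys ≋ xs
  ≋-sym []            = []
  ≋-sym (p ∷ q)       = ≈-sym p ∷ ≋-sym q
  ≋-sym (swap x y xs) = swap y x xs
  ≋-sym (≋-trans p q) = ≋-trans (≋-sym q) (≋-sym p)

≈-trans : ∀ {x y z} → x ≈ y → y ≈ z → x ≈ z
≈-trans (node p) (node q) = node (≋-trans p q)

≡⇒≋ : ∀ {xs ys} → xs ≡ ys → xs ≋ ys
≡⇒≋ {xs} ≡.refl = ≋-refl xs

↭⇒≋ : ∀ {xs ys} → xs ↭ ys → xs ≋ ys
↭⇒≋ {xs} ↭.refl  = ≋-refl xs
↭⇒≋ (↭.prep x p) = ≈-refl ∷ ↭⇒≋ p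
↭⇒≋ (↭.swap x y p) = ≋-trans (swap x y _) (≈-refl ∷ ≈-refl ∷ ↭⇒≋ p)
↭⇒≋ (↭.trans p q) = ≋-trans (↭⇒≋ p) (↭⇒≋ q)

pointwise⇒≋ : ∀ {xs ys} → Pointwise _≈_ xs ys → xs ≋ ys
pointwise⇒≋ []      = []
pointwise⇒≋ (p ∷ q) = p ∷ pointwise⇒≋ q

++-cong : ∀ {xs ys zs ws} → xs ≋ ys → zs ≋ ws → xs ++ zs ≋ ys ++ ws
++-cong {ys = ys} {zs = zs} p q = ≋-trans (congˡ p) (congʳ ys q)
  where
  congˡ : ∀ {xs ys} → xs ≋ ys → xs ++ zs ≋ ys ++ zs
  congˡ []            = ≋-refl zs
  congˡ (p ∷ q)       = p ∷ congˡ q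
  congˡ (swap x y xs) = swap x y (xs ++ zs)
  congˡ (≋-trans p q) = ≋-trans (congˡ p) (congˡ q)

  congʳ : ∀ xs {zs ws} → zs ≋ ws → xs ++ zs ≋ xs ++ ws
  congʳ []       q = q
  congʳ (x ∷ xs) q = ≈-refl ∷ congʳ xs q

commute : ∀ {E : Set} {R : E → E → Set} {as bs cs} →
          Pointwise R as bs → bs ↭ cs → ∃ λ as′ → as ↭ as′ × Pointwise R as′ cs
commute rel ↭.refl = _ , ↭.refl , rel
commute (r ∷ rel) (↭.prep _ ρ) with _ , ρ′ , rel′ ← commute rel ρ
  = _ , ↭.prep _ ρ′ , r ∷ rel′
commute (r ∷ s ∷ rel) (↭.swap _ _ ρ) with _ , ρ′ , rel′ ← commute rel ρ
  = _ , ↭.swap _ _ ρ′ , s ∷ r ∷ rel′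
commute rel (↭.trans ρ₁ ρ₂) with _ , ρ₁′ , rel₁ ← commute rel ρ₁
                            with _ , ρ₂′ , rel₂ ← commute rel₁ ρ₂
  = _ , ↭.trans ρ₁′ ρ₂′ , rel₂

decompose : ∀ {xs ys} → xs ≋ ys → ∃ λ zs → xs ↭ zs × Pointwise _≈_ zs ys
decompose []      = [] , ↭.refl , []
decompose (p ∷ q) with _ , ρ , rel ← decompose q = _ , ↭.prep _ ρ , p ∷ rel
decompose (swap x y xs) = y ∷ x ∷ xs , ↭.swap x y ↭.refl , Pointwise.refl ≈-refl
decompose (≋-trans p q) with _ , ρ₁ , rel₁ ← decompose p
                        with _ , ρ₂ , rel₂ ← decompose q
                        with _ , ρ₂′ , rel₂′ ← commute rel₁ ρ₂
  = _ , ↭.trans ρ₁ ρ₂′ , Pointwise.transitive ≈-trans rel₂′ rel₂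

pointwise-split : ∀ {A B : Set} {R : B → B → Set} (g : A → B) ys₁ {ys₂} xs →
  Pointwise R (map g xs) (ys₁ ++ ys₂) →
  ∃₂ λ xs₁ xs₂ → xs ≡ xs₁ ++ xs₂ × Pointwise R (map g xs₁) ys₁ × Pointwise R (map g xs₂) ys₂
pointwise-split g []         xs       rel = [] , xs , ≡.refl , [] , rel
pointwise-split g (y ∷ ys₁)  []       ()
pointwise-split g (y ∷ ys₁)  (x ∷ xs) (r ∷ rel)
  with xs₁ , xs₂ , ≡.refl , rel₁ , rel₂ ← pointwise-split g ys₁ xs rel
  = x ∷ xs₁ , xs₂ , ≡.refl , r ∷ rel₁ , rel₂

-- `as ⇒ᴺ x` is the normal form of (⋀ as) ⇒ x: the premises as are added to x.
_⇒ᴺ_ : List Nf → Nf → Nf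
as ⇒ᴺ node ms = node (as ++ ms)

⟦_⟧ : Ty → List⁺ Nf
⟦ τ ⟧     = [ node [] ]
⟦ X ∧ Y ⟧ = ⟦ X ⟧ ⁺++⁺ ⟦ Y ⟧
⟦ X ⇒ Y ⟧ = List⁺.map (toList ⟦ X ⟧ ⇒ᴺ_) ⟦ Y ⟧

map-⇒ᴺ-cong : ∀ {as bs xs ys} → as ≋ bs → xs ≋ ys → map (as ⇒ᴺ_) xs ≋ map (bs ⇒ᴺ_) ys
map-⇒ᴺ-cong {as} {bs} {xs} a p = ≋-trans (congˡ xs) (congʳ p)
  where
  congˡ : ∀ xs → map (as ⇒ᴺ_) xs ≋ map (bs ⇒ᴺ_) xs
  congˡ []             = []
  congˡ (node ms ∷ xs) = node (++-cong a (≋-refl ms)) ∷ congˡ xs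

  congʳ : ∀ {xs ys} → xs ≋ ys → map (bs ⇒ᴺ_) xs ≋ map (bs ⇒ᴺ_) ys
  congʳ []              = []
  congʳ (node p ∷ q)    = node (++-cong (≋-refl bs) p) ∷ congʳ q
  congʳ (swap x y xs)   = swap _ _ _
  congʳ (≋-trans p q)   = ≋-trans (congʳ p) (congʳ q)

⇒ᴺ-++ : ∀ as bs x → (as ++ bs) ⇒ᴺ x ≡ as ⇒ᴺ (bs ⇒ᴺ x)
⇒ᴺ-++ as bs (node ms) = ≡.cong node (++-assoc as bs ms)

sound : ∀ {X Y} → X ≡ᵗ Y → toList ⟦ X ⟧ ≋ toList ⟦ Y ⟧
sound {X} refl    = ≋-refl (toList ⟦ X ⟧)
sound (sym p)     = ≋-sym (sound p)
sound (trans p q) = ≋-trans (sound p) (sound q)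
sound (cong⇒ p q) = map-⇒ᴺ-cong (sound p) (sound q)
sound (cong∧ p q) = ++-cong (sound p) (sound q)
sound {A ∧ B} comm = ↭⇒≋ (++-comm (toList ⟦ A ⟧) (toList ⟦ B ⟧))
sound {A ∧ (B ∧ C)} assoc = ≡⇒≋ (≡.sym (++-assoc (toList ⟦ A ⟧) (toList ⟦ B ⟧) (toList ⟦ C ⟧)))
sound {A ⇒ (B ∧ C)} distr = ≡⇒≋ (map-++ (toList ⟦ A ⟧ ⇒ᴺ_) (toList ⟦ B ⟧) (toList ⟦ C ⟧))
sound {(A ∧ B) ⇒ C} curry =
  ≡⇒≋ (≡.trans (map-cong (⇒ᴺ-++ (toList ⟦ A ⟧) (toList ⟦ B ⟧)) (toList ⟦ C ⟧))
               (map-∘ (toList ⟦ C ⟧)))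

mutual
  reify : Nf → Ty
  reify (node ms) = arrows ms

  arrows : List Nf → Ty
  arrows []       = τ
  arrows (m ∷ ms) = reify m ⇒ arrows ms

_⊗_ : Ty → List Nf → Ty
X ⊗ xs = foldl (λ T x → T ∧ reify x) X xs

-- The conjunction of a list of normal forms (only used on nonempty lists).
⋀ : List Nf → Ty
⋀ []       = τ
⋀ (x ∷ xs) = reify x ⊗ xs

mutual
  reify-cong : ∀ {x y} → x ≈ y → reify x ≡ᵗ reify y
  reify-cong (node p) = arrows-cong p

  arrows-cong : ∀ {xs ys} → xs ≋ ys → arrows xs ≡ᵗ arrows ys
  arrows-cong []            = refl
  arrows-cong (p ∷ q)       = cong⇒ (reify-cong p) (arrows-cong q)
  arrows-cong (swap x y xs) = exchange
  arrows-cong (≋-trans p q) = trans (arrows-cong p) (arrows-cong q)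

⊗-congˡ : ∀ {X X′} → X ≡ᵗ X′ → ∀ xs → X ⊗ xs ≡ᵗ X′ ⊗ xs
⊗-congˡ e []       = e
⊗-congˡ e (x ∷ xs) = ⊗-congˡ (cong∧ e refl) xs

⊗-cong : ∀ {X X′ xs ys} → X ≡ᵗ X′ → xs ≋ ys → X ⊗ xs ≡ᵗ X′ ⊗ ys
⊗-cong e []            = e
⊗-cong e (p ∷ q)       = ⊗-cong (cong∧ e (reify-cong p)) q
⊗-cong e (swap x y xs) = ⊗-congˡ (trans (cong∧ (cong∧ e refl) refl) rotate) xs
⊗-cong e (≋-trans p q) = trans (⊗-cong e p) (⊗-cong refl q)

⋀-cong : ∀ {xs ys} → xs ≋ ys → ⋀ xs ≡ᵗ ⋀ ys
⋀-cong []            = refl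
⋀-cong (p ∷ q)       = ⊗-cong (reify-cong p) q
⋀-cong (swap x y xs) = ⊗-congˡ comm xs
⋀-cong (≋-trans p q) = trans (⋀-cong p) (⋀-cong q)

⊗-∧ : ∀ X Y ys → (X ∧ Y) ⊗ ys ≡ᵗ X ∧ (Y ⊗ ys)
⊗-∧ X Y []       = refl
⊗-∧ X Y (y ∷ ys) = trans (⊗-congˡ (sym assoc) ys) (⊗-∧ X (Y ∧ reify y) ys)

⋀-++ : ∀ L M → ⋀ (toList L ++ toList M) ≡ᵗ ⋀ (toList L) ∧ ⋀ (toList M)
⋀-++ (x ∷ xs) (y ∷ ys) =
  trans (≡⇒≡ᵗ (foldl-++ _ (reify x) xs (y ∷ ys))) (⊗-∧ (reify x ⊗ xs) (reify y) ys)

arrows-++ : ∀ X as ms → X ⇒ arrows (as ++ ms) ≡ᵗ (X ⊗ as) ⇒ arrows ms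
arrows-++ X []       ms = refl
arrows-++ X (a ∷ as) ms = trans (sym curry) (arrows-++ (X ∧ reify a) as ms)

reify-⇒ᴺ : ∀ L y → reify (toList L ⇒ᴺ y) ≡ᵗ ⋀ (toList L) ⇒ reify y
reify-⇒ᴺ (a ∷ as) (node ms) = arrows-++ (reify a) as ms

⊗-map : ∀ {Z} (g : Nf → Nf) → (∀ y → reify (g y) ≡ᵗ Z ⇒ reify y) →
        ∀ X ys → (Z ⇒ X) ⊗ map g ys ≡ᵗ Z ⇒ (X ⊗ ys)
⊗-map g g-spec X []       = refl
⊗-map g g-spec X (y ∷ ys) =
  trans (⊗-congˡ (trans (cong∧ refl (g-spec y)) (sym distr)) (map g ys))
        (⊗-map g g-spec (X ∧ reify y) ys)

⋀-map : ∀ L M → ⋀ (map (toList L ⇒ᴺ_) (toList M)) ≡ᵗ ⋀ (toList L) ⇒ ⋀ (toList M)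
⋀-map L (y ∷ ys) =
  trans (⊗-congˡ (reify-⇒ᴺ L y) (map _ ys)) (⊗-map _ (reify-⇒ᴺ L) (reify y) ys)

normalForm : ∀ X → X ≡ᵗ ⋀ (toList ⟦ X ⟧)
normalForm τ       = refl
normalForm (X ∧ Y) = trans (cong∧ (normalForm X) (normalForm Y)) (sym (⋀-++ ⟦ X ⟧ ⟦ Y ⟧))
normalForm (X ⇒ Y) = trans (cong⇒ (normalForm X) (normalForm Y)) (sym (⋀-map ⟦ X ⟧ ⟦ Y ⟧))

component : ∀ A C {bs} → Pointwise _≈_ (map (toList ⟦ A ⟧ ⇒ᴺ_) bs) (toList ⟦ C ⟧) →
            Σ[ B′ ∈ List⁺ Nf ] (bs ≡ toList B′ × C ≡ᵗ A ⇒ ⋀ (toList B′))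
component A C {b ∷ bs} rel =
  b ∷ bs , ≡.refl ,
  trans (normalForm C)
    (trans (⋀-cong (≋-sym (pointwise⇒≋ rel)))
      (trans (⋀-map ⟦ A ⟧ (b ∷ bs)) (cong⇒ (sym (normalForm A)) refl)))

mainTheorem19 : (A B C₁ C₂ : Ty) → (A ⇒ B) ≡ᵗ (C₁ ∧ C₂) →
    Σ[ B₁ ∈ Ty ] Σ[ B₂ ∈ Ty ] ((C₁ ≡ᵗ (A ⇒ B₁)) × (C₂ ≡ᵗ (A ⇒ B₂)) × (B ≡ᵗ (B₁ ∧ B₂)))
mainTheorem19 A B C₁ C₂ A⇒B≡C₁∧C₂
  with zs , ⟦A⇒B⟧↭zs , zs≈⟦C₁∧C₂⟧ ← decompose (sound A⇒B≡C₁∧C₂)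
  with bs , ≡.refl , ⟦B⟧↭bs ← ↭-map-inv (toList ⟦ A ⟧ ⇒ᴺ_) ⟦A⇒B⟧↭zs
  with bs₁ , bs₂ , ≡.refl , rel₁ , rel₂ ← pointwise-split _ (toList ⟦ C₁ ⟧) bs zs≈⟦C₁∧C₂⟧
  with B₁ , ≡.refl , C₁≡A⇒B₁ ← component A C₁ rel₁
  with B₂ , ≡.refl , C₂≡A⇒B₂ ← component A C₂ rel₂
  = ⋀ (toList B₁) , ⋀ (toList B₂) , C₁≡A⇒B₁ , C₂≡A⇒B₂ ,
    trans (normalForm B) (trans (⋀-cong (↭⇒≋ ⟦B⟧↭bs)) (⋀-++ B₁ B₂))
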